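{- Let $(c_i)_{i\ge 1}$ and $(\mathrm{ab}_i)_{i\ge 2}$ be arbitrary sequences of complex numbers, let $Q_h(z)$ be defined by $Q_0(z)=1$, $Q_1(z)=1-c_1z$, and $Q_h(z)=(1-c_hz)Q_{h-1}(z)-\mathrm{ab}_hz^2Q_{h-2}(z)$ for $h\ge 2$. Then for every integer $h\ge 2$: (i) $$Q_h(z)=(1-c_1z)\cdots(1-c_hz)\left[1+\sum_{m=1}^{\lfloor h/2\rfloor}\sum_{s=0}^{mh}(-z^2)^m S_{h,m,s}(z)\right];$$ (ii) for all $0\le n\le h$, $$[z^n]Q_h(z)=\left[{h \atop n}\right]_c+\sum_{m=1}^{\lfloor h/2\rfloor}\sum_{s=0}^{mh}\sum_{k=0}^{n}(-1)^m\left[{h \atop n-k}\right]_c\,[z^{k-2m}]S_{h,m,s}(z).$$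
   Context: For integers $h\ge 2$, $1\le m\le h$, $s\ge 0$, define the rational function $$S_{h,m,s}(z):=\sum_{k_1=2}^{h-2(m-1)}\ \sum_{k_2=k_1+2}^{h-2(m-2)}\cdots\sum_{k_m=k_{m-1}+2}^{h}\left[\prod_{p=1}^{m}\frac{\mathrm{ab}_{k_p}}{(1-c_{k_p}z)(1-c_{k_p-1}z)}\right]\cdot[k_1+\cdots+k_m=s],$$ where $[\cdot]$ is $1$ if the condition holds and $0$ otherwise. The coefficients $\left[{h \atop k}\right]_c$ are defined by $\left[{h \atop k}\right]_c=0$ if $h<0$ or $k<0$, and $\left[{h \atop k}\right]_c=\left[{h-1 \atop k}\right]_c-c_h\left[{h-1 \atop k-1}\right]_c+[h=k=0]$ otherwise (so they are the coefficients of $\prod_{i=1}^h(1-c_iz)$). $[z^j]F(z)$ denotes the coefficient of $z^j$ in the power series expansion of $F$ about $z=0$, taken to be $0$ for $j<0$. -}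

module Defs where

open import Data.Nat as ℕ using (ℕ; zero; suc; _∸_; _≤?_; _≟_)
open import Data.List using (List; []; _∷_; map; foldr; concatMap; upTo)
open import Relation.Nullary using (yes; no)
open import Algebra.Bundles using (CommutativeRing)

range : ℕ → ℕ → List ℕ
range lo hi = map (lo ℕ.+_) (upTo (suc hi ∸ lo))

-- all index tuples (k_1,...,k_m) with lo ≤ k_1, k_{p+1} ≥ k_p + 2, k_m ≤ h.
-- With lo = 2 these are exactly the tuples of the nested sum defining S_{h,m,s}
-- (the bounds k_p ≤ h - 2(m-p) are implied by k_m ≤ h and the gaps).
chains : (h lo m : ℕ) → List (List ℕ)
chains h lo zero = [] ∷ []
chains h lo (suc m) =
  concatMap (λ k → map (k ∷_) (chains h (suc (suc k)) m)) (range lo h)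

sumℕ : List ℕ → ℕ
sumℕ = foldr ℕ._+_ 0

-- Rational functions in z whose denominators are products of (1 - c z) are
-- represented by their power series expansion at z = 0.
module PowerSeries {a ℓ} (R : CommutativeRing a ℓ) where
  open CommutativeRing R hiding (zero)

  PS : Set a
  PS = ℕ → Carrier

  sumL : List Carrier → Carrier
  sumL = foldr _+_ 0#

  sumRange : ℕ → ℕ → (ℕ → Carrier) → Carrier
  sumRange lo hi f = sumL (map f (range lo hi))

  pow : Carrier → ℕ → Carrier
  pow x zero = 1#
  pow x (suc n) = x * pow x n

  cst : Carrier → PS
  cst x zero = x
  cst x (suc n) = 0#

  Z : PS
  Z zero = 0#
  Z (suc zero) = 1#
  Z (suc (suc n)) = 0#

  _⊕_ : PS → PS → PS
  (f ⊕ g) n = f n + g n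

  ⊝_ : PS → PS
  (⊝ f) n = - f n

  _⊖_ : PS → PS → PS
  f ⊖ g = f ⊕ (⊝ g)

  _⊛_ : PS → PS → PS
  (f ⊛ g) n = sumRange 0 n (λ k → f k * g (n ∸ k))

  powPS : PS → ℕ → PS
  powPS f zero = cst 1#
  powPS f (suc n) = f ⊛ powPS f n

  sumPSL : List PS → PS
  sumPSL = foldr _⊕_ (cst 0#)

  prodPSL : List PS → PS
  prodPSL = foldr _⊛_ (cst 1#)

  sumPS : ℕ → ℕ → (ℕ → PS) → PS
  sumPS lo hi F = sumPSL (map F (range lo hi))

  lin : Carrier → PS
  lin x = cst 1# ⊖ (cst x ⊛ Z)

  -- 1 / (1 - x z) = Σ_n x^n z^n
  geom : Carrier → PS
  geom x n = pow x n

  indicator : ℕ → ℕ → Carrier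
  indicator s t with s ≟ t
  ... | yes _ = 1#
  ... | no _ = 0#

  -- [z^(k - d)] F, taken to be 0 when k - d < 0
  coeffShift : PS → ℕ → ℕ → Carrier
  coeffShift F k d with d ≤? k
  ... | yes _ = F (k ∸ d)
  ... | no _ = 0#

  module _ (c ab : ℕ → Carrier) where

    term : ℕ → PS
    term k = cst (ab k) ⊛ (geom (c k) ⊛ geom (c (k ∸ 1)))

    S : (h m s : ℕ) → PS
    S h m s = sumPSL (map (λ ks → cst (indicator (sumℕ ks) s) ⊛ prodPSL (map term ks))
                          (chains h 2 m))

    Q : ℕ → PS
    Q zero = cst 1#
    Q (suc zero) = lin (c 1)
    Q (suc (suc h)) =
      (lin (c (suc (suc h))) ⊛ Q (suc h)) ⊖ ((cst (ab (suc (suc h))) ⊛ (Z ⊛ Z)) ⊛ Q h)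

    prodLin : ℕ → PS
    prodLin zero = cst 1#
    prodLin (suc h) = prodLin h ⊛ lin (c (suc h))

    bracket : ℕ → ℕ → Carrier
    bracket zero zero = 1#
    bracket zero (suc k) = 0#
    bracket (suc h) zero = bracket h zero
    bracket (suc h) (suc k) = bracket h (suc k) - c (suc h) * bracket h k

module Submission where

-- Summing out the indicator [k₁ + ⋯ + kₘ = s], the bracket in (i) becomes the polynomial
-- B_h = Σₘ (-z²)ᵐ Σ_{2 ≤ k₁, k_{p+1} ≥ k_p + 2, kₘ ≤ h} Πₚ t_{k_p}  with  t_k = ab_k / ((1 - c_k z)(1 - c_{k-1} z)).
-- Splitting off the chains that end at h gives B_h = B_{h-1} - z² t_h B_{h-2}, and multiplying by
-- (1 - c₁z)⋯(1 - c_h z) cancels the denominators of t_h, so (1 - c₁z)⋯(1 - c_h z) B_h satisfies the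
-- recurrence of Q_h. Part (ii) is the coefficient of zⁿ in (i): the coefficients of the product are the
-- [h k]_c, and multiplying by (-z²)ᵐ shifts coefficients by 2m.

open import Defs
open import Data.Nat as ℕ using (ℕ; zero; suc; _∸_; _≤_; _<_; z≤n; s≤s; _≤?_; ⌊_/2⌋)
import Data.Nat.Properties as ℕₚ
open import Data.List using (List; []; _∷_; map; foldr; concatMap; upTo; applyUpTo; _++_)
open import Data.List.Properties using (map-applyUpTo; map-upTo; map-cong; map-∘; applyUpTo-∷ʳ)
open import Data.List.Relation.Unary.All as All using (All; []; _∷_)
import Data.List.Relation.Unary.All.Properties as Allₚ
open import Data.Product using (_×_; _,_)
open import Function using (_∘_; id)
open import Algebra.Bundles using (CommutativeRing; Semiring)
open import Relation.Binary.PropositionalEquality as ≡ using (_≡_; _≢_)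
open import Data.Sum using (_⊎_; inj₁; inj₂)
open import Relation.Nullary using (yes; no)
open import Data.Empty using (⊥-elim)

range-≤ : ∀ {lo h} → lo ≤ h → range lo h ≡ lo ∷ range (suc lo) h
range-≤ {lo} {h} lo≤h rewrite ℕₚ.+-∸-assoc 1 lo≤h =
  ≡.cong₂ _∷_ (ℕₚ.+-identityʳ lo)
    (≡.trans (map-applyUpTo suc (lo ℕ.+_) (h ∸ lo))
    (≡.trans (≡.sym (map-upTo (λ i → lo ℕ.+ suc i) (h ∸ lo)))
             (map-cong (ℕₚ.+-suc lo) (upTo (h ∸ lo)))))

range-> : ∀ {lo h} → h < lo → range lo h ≡ []
range-> {lo} {h} h<lo rewrite ℕₚ.m≤n⇒m∸n≡0 h<lo = ≡.refl

lo+i≤h : ∀ lo i h → i < suc h ∸ lo → lo ℕ.+ i ≤ h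
lo+i≤h zero      i h       i<h+1 = ℕₚ.≤-pred i<h+1
lo+i≤h (suc lo) i (suc h) i<h-lo = s≤s (lo+i≤h lo i h i<h-lo)
lo+i≤h (suc lo) i zero    i<0 with () ← ≡.subst (i <_) (ℕₚ.0∸n≡0 lo) i<0

All-range : ∀ {p} {P : ℕ → Set p} lo h → (∀ k → k ≤ h → P k) → All P (range lo h)
All-range lo h P≤h =
  Allₚ.map⁺ (Allₚ.applyUpTo⁺₁ id (suc h ∸ lo) (λ {i} i<h-lo → P≤h (lo ℕ.+ i) (lo+i≤h lo i h i<h-lo)))

module Sums {c ℓ} (T : CommutativeRing c ℓ) where
  open CommutativeRing T
  open import Algebra.Properties.CommutativeSemigroup +-commutativeSemigroup using (interchange)
  open import Relation.Binary.Reasoning.Setoid setoid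

  sum : List Carrier → Carrier
  sum = foldr _+_ 0#

  module _ {b} {A : Set b} where

    sum-congᴬ : ∀ {f g : A → Carrier} {xs} → All (λ x → f x ≈ g x) xs → sum (map f xs) ≈ sum (map g xs)
    sum-congᴬ []       = refl
    sum-congᴬ (p ∷ ps) = +-cong p (sum-congᴬ ps)

    sum-cong : ∀ {f g : A → Carrier} → (∀ x → f x ≈ g x) → ∀ xs → sum (map f xs) ≈ sum (map g xs)
    sum-cong f≈g xs = sum-congᴬ (All.universal f≈g xs)

    sum-0 : ∀ (xs : List A) → sum (map (λ _ → 0#) xs) ≈ 0#
    sum-0 []       = refl
    sum-0 (x ∷ xs) = trans (+-identityˡ _) (sum-0 xs)

    sum-+ : ∀ (f g : A → Carrier) xs → sum (map (λ x → f x + g x) xs) ≈ sum (map f xs) + sum (map g xs)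
    sum-+ f g []       = sym (+-identityˡ 0#)
    sum-+ f g (x ∷ xs) = trans (+-congˡ (sum-+ f g xs)) (interchange _ _ _ _)

    sum-*ˡ : ∀ a (f : A → Carrier) xs → sum (map (λ x → a * f x) xs) ≈ a * sum (map f xs)
    sum-*ˡ a f []       = sym (zeroʳ a)
    sum-*ˡ a f (x ∷ xs) = trans (+-congˡ (sum-*ˡ a f xs)) (sym (distribˡ _ _ _))

    sum-*ʳ : ∀ a (f : A → Carrier) xs → sum (map (λ x → f x * a) xs) ≈ sum (map f xs) * a
    sum-*ʳ a f []       = sym (zeroˡ a)
    sum-*ʳ a f (x ∷ xs) = trans (+-congˡ (sum-*ʳ a f xs)) (sym (distribʳ _ _ _))

    sum-++ : ∀ (f : A → Carrier) xs ys → sum (map f (xs ++ ys)) ≈ sum (map f xs) + sum (map f ys)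
    sum-++ f []       ys = sym (+-identityˡ _)
    sum-++ f (x ∷ xs) ys = trans (+-congˡ (sum-++ f xs ys)) (sym (+-assoc _ _ _))

    sum-map : ∀ {d} {D : Set d} (f : A → Carrier) (g : D → A) xs → sum (map f (map g xs)) ≡ sum (map (f ∘ g) xs)
    sum-map f g xs = ≡.cong sum (≡.sym (map-∘ xs))

    sum-concatMap : ∀ {d} {D : Set d} (f : A → Carrier) (g : D → List A) xs →
                    sum (map f (concatMap g xs)) ≈ sum (map (λ x → sum (map f (g x))) xs)
    sum-concatMap f g []       = refl
    sum-concatMap f g (x ∷ xs) = trans (sum-++ f (g x) _) (+-congˡ (sum-concatMap f g xs))

  sum-upTo-suc : ∀ (f : ℕ → Carrier) M → sum (map f (upTo (suc M))) ≡ f 0 + sum (map (f ∘ suc) (upTo M))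
  sum-upTo-suc f M = ≡.cong (λ xs → f 0 + sum xs) (≡.trans (map-applyUpTo suc f M) (≡.sym (map-upTo (f ∘ suc) M)))

  sum-upTo-∷ʳ : ∀ (f : ℕ → Carrier) K → sum (map f (upTo (suc K))) ≈ sum (map f (upTo K)) + f K
  sum-upTo-∷ʳ f K = begin
    sum (map f (upTo (suc K)))               ≡⟨ ≡.cong (sum ∘ map f) (applyUpTo-∷ʳ id K) ⟨
    sum (map f (upTo K ++ K ∷ []))           ≈⟨ sum-++ f (upTo K) (K ∷ []) ⟩
    sum (map f (upTo K)) + (f K + 0#)        ≈⟨ +-congˡ (+-identityʳ (f K)) ⟩
    sum (map f (upTo K)) + f K               ∎

  sum-comm : ∀ {b d} {A : Set b} {D : Set d} (g : A → D → Carrier) xs ys →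
             sum (map (λ x → sum (map (g x) ys)) xs) ≈ sum (map (λ y → sum (map (λ x → g x y) xs)) ys)
  sum-comm g []       ys = sym (sum-0 ys)
  sum-comm g (x ∷ xs) ys = trans (+-congˡ (sum-comm g xs ys)) (sym (sum-+ (g x) _ ys))

module PowerSeriesRing {a ℓ} (R : CommutativeRing a ℓ) where
  open CommutativeRing R hiding (zero)
  open PowerSeries R
  open Sums R
  open import Relation.Binary.Reasoning.Setoid setoid
  open import Algebra.Properties.CommutativeSemigroup +-commutativeSemigroup using (interchange)

  infix 4 _≋_
  _≋_ : PS → PS → Set ℓ
  f ≋ g = ∀ n → f n ≈ g n

  -- Indexed by applyUpTo so that conv f g (suc n) unfolds to f 0 * g (suc n) + conv (f ∘ suc) g n.
  conv : PS → PS → PS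
  conv f g n = sum (applyUpTo (λ k → f k * g (n ∸ k)) (suc n))

  ⊛≈conv : ∀ f g → f ⊛ g ≋ conv f g
  ⊛≈conv f g n = reflexive (≡.trans (sum-map (λ k → f k * g (n ∸ k)) (0 ℕ.+_) (upTo (suc n)))
                                    (≡.cong sum (map-upTo (λ k → f k * g (n ∸ k)) (suc n))))

  conv-cong : ∀ {f f′ g g′} → f ≋ f′ → g ≋ g′ → conv f g ≋ conv f′ g′
  conv-cong f≋f′ g≋g′ zero    = +-congʳ (*-cong (f≋f′ 0) (g≋g′ 0))
  conv-cong f≋f′ g≋g′ (suc n) = +-cong (*-cong (f≋f′ 0) (g≋g′ (suc n))) (conv-cong (f≋f′ ∘ suc) g≋g′ n)

  conv-zeroˡ : ∀ g n → conv (λ _ → 0#) g n ≈ 0#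
  conv-zeroˡ g zero    = trans (+-identityʳ _) (zeroˡ _)
  conv-zeroˡ g (suc n) = trans (+-cong (zeroˡ _) (conv-zeroˡ g n)) (+-identityˡ _)

  conv-identityˡ : ∀ g → conv (cst 1#) g ≋ g
  conv-identityˡ g zero    = trans (+-identityʳ _) (*-identityˡ _)
  conv-identityˡ g (suc n) = trans (+-cong (*-identityˡ _) (conv-zeroˡ g n)) (+-identityʳ _)

  conv-*ˡ : ∀ x f g → conv (λ k → x * f k) g ≋ (λ n → x * conv f g n)
  conv-*ˡ x f g zero    = trans (+-cong (*-assoc _ _ _) (sym (zeroʳ x))) (sym (distribˡ _ _ _))
  conv-*ˡ x f g (suc n) = trans (+-cong (*-assoc _ _ _) (conv-*ˡ x (f ∘ suc) g n)) (sym (distribˡ _ _ _))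

  conv-+ˡ : ∀ f f′ g → conv (f ⊕ f′) g ≋ conv f g ⊕ conv f′ g
  conv-+ˡ f f′ g zero    = trans (+-congʳ (distribʳ _ _ _)) (trans (+-congˡ (sym (+-identityʳ 0#))) (interchange _ _ _ _))
  conv-+ˡ f f′ g (suc n) = trans (+-cong (distribʳ _ _ _) (conv-+ˡ (f ∘ suc) (f′ ∘ suc) g n)) (interchange _ _ _ _)

  conv-+ʳ : ∀ f g g′ → conv f (g ⊕ g′) ≋ conv f g ⊕ conv f g′
  conv-+ʳ f g g′ zero    = trans (+-congʳ (distribˡ _ _ _)) (trans (+-congˡ (sym (+-identityʳ 0#))) (interchange _ _ _ _))
  conv-+ʳ f g g′ (suc n) = trans (+-cong (distribˡ _ _ _) (conv-+ʳ (f ∘ suc) g g′ n)) (interchange _ _ _ _)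

  conv-sucʳ : ∀ f g n → conv f g (suc n) ≈ conv f (g ∘ suc) n + f (suc n) * g 0
  conv-sucʳ f g zero    = trans (+-congˡ (+-identityʳ _)) (+-congʳ (sym (+-identityʳ _)))
  conv-sucʳ f g (suc n) = trans (+-congˡ (conv-sucʳ (f ∘ suc) g n)) (sym (+-assoc _ _ _))

  conv-comm : ∀ f g → conv f g ≋ conv g f
  conv-comm f g zero    = +-congʳ (*-comm _ _)
  conv-comm f g (suc n) = begin
    f 0 * g (suc n) + conv (f ∘ suc) g n  ≈⟨ +-cong (*-comm _ _) (conv-comm (f ∘ suc) g n) ⟩
    g (suc n) * f 0 + conv g (f ∘ suc) n  ≈⟨ +-comm _ _ ⟩
    conv g (f ∘ suc) n + g (suc n) * f 0  ≈⟨ conv-sucʳ g f n ⟨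
    conv g f (suc n)                      ∎

  conv-assoc : ∀ f g h → conv (conv f g) h ≋ conv f (conv g h)
  conv-assoc f g h zero    = +-congʳ (trans (*-congʳ (+-identityʳ _)) (trans (*-assoc _ _ _) (*-congˡ (sym (+-identityʳ _)))))
  conv-assoc f g h (suc n) = begin
    conv f g 0 * h (suc n) + conv (λ k → f 0 * g (suc k) + conv (f ∘ suc) g k) h n
      ≈⟨ +-congˡ (conv-+ˡ (λ k → f 0 * g (suc k)) (conv (f ∘ suc) g) h n) ⟩
    conv f g 0 * h (suc n) + (conv (λ k → f 0 * g (suc k)) h n + conv (conv (f ∘ suc) g) h n)
      ≈⟨ +-congˡ (+-cong (conv-*ˡ (f 0) (g ∘ suc) h n) (conv-assoc (f ∘ suc) g h n)) ⟩
    conv f g 0 * h (suc n) + (f 0 * conv (g ∘ suc) h n + conv (f ∘ suc) (conv g h) n)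
      ≈⟨ +-assoc _ _ _ ⟨
    (conv f g 0 * h (suc n) + f 0 * conv (g ∘ suc) h n) + conv (f ∘ suc) (conv g h) n
      ≈⟨ +-congʳ (+-congʳ (trans (*-congʳ (+-identityʳ _)) (*-assoc _ _ _))) ⟩
    (f 0 * (g 0 * h (suc n)) + f 0 * conv (g ∘ suc) h n) + conv (f ∘ suc) (conv g h) n
      ≈⟨ +-congʳ (distribˡ _ _ _) ⟨
    f 0 * conv g h (suc n) + conv (f ∘ suc) (conv g h) n
      ∎

  ⊛-cong : ∀ {f f′ g g′} → f ≋ f′ → g ≋ g′ → f ⊛ g ≋ f′ ⊛ g′
  ⊛-cong {f} {f′} {g} {g′} f≋f′ g≋g′ n =
    trans (⊛≈conv f g n) (trans (conv-cong f≋f′ g≋g′ n) (sym (⊛≈conv f′ g′ n)))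

  ⊛-comm : ∀ f g → f ⊛ g ≋ g ⊛ f
  ⊛-comm f g n = trans (⊛≈conv f g n) (trans (conv-comm f g n) (sym (⊛≈conv g f n)))

  ⊛-assoc : ∀ f g h → (f ⊛ g) ⊛ h ≋ f ⊛ (g ⊛ h)
  ⊛-assoc f g h n = begin
    ((f ⊛ g) ⊛ h) n   ≈⟨ ⊛≈conv (f ⊛ g) h n ⟩
    conv (f ⊛ g) h n  ≈⟨ conv-cong {g = h} (⊛≈conv f g) (λ _ → refl) n ⟩
    conv (conv f g) h n ≈⟨ conv-assoc f g h n ⟩
    conv f (conv g h) n ≈⟨ conv-cong {f = f} (λ _ → refl) (λ k → sym (⊛≈conv g h k)) n ⟩
    conv f (g ⊛ h) n  ≈⟨ ⊛≈conv f (g ⊛ h) n ⟨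
    (f ⊛ (g ⊛ h)) n   ∎

  ⊛-identityˡ : ∀ g → cst 1# ⊛ g ≋ g
  ⊛-identityˡ g n = trans (⊛≈conv (cst 1#) g n) (conv-identityˡ g n)

  ⊛-identityʳ : ∀ g → g ⊛ cst 1# ≋ g
  ⊛-identityʳ g n = trans (⊛-comm g _ n) (⊛-identityˡ g n)

  ⊛-distribˡ : ∀ f g h → f ⊛ (g ⊕ h) ≋ (f ⊛ g) ⊕ (f ⊛ h)
  ⊛-distribˡ f g h n = trans (⊛≈conv f (g ⊕ h) n) (trans (conv-+ʳ f g h n) (sym (+-cong (⊛≈conv f g n) (⊛≈conv f h n))))

  ⊛-distribʳ : ∀ f g h → (g ⊕ h) ⊛ f ≋ (g ⊛ f) ⊕ (h ⊛ f)
  ⊛-distribʳ f g h n = trans (⊛≈conv (g ⊕ h) f n) (trans (conv-+ˡ g h f n) (sym (+-cong (⊛≈conv g f n) (⊛≈conv h f n))))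

  cst-0# : cst 0# ≋ (λ _ → 0#)
  cst-0# zero    = refl
  cst-0# (suc n) = refl

  powerSeriesRing : CommutativeRing a ℓ
  powerSeriesRing = record
    { Carrier = PS ; _≈_ = _≋_ ; _+_ = _⊕_ ; _*_ = _⊛_ ; -_ = ⊝_ ; 0# = cst 0# ; 1# = cst 1#
    ; isCommutativeRing = record
      { isRing = record
        { +-isAbelianGroup = record
          { isGroup = record
            { isMonoid = record
              { isSemigroup = record
                { isMagma = record
                  { isEquivalence = record
                    { refl = λ _ → refl ; sym = λ f≋g n → sym (f≋g n) ; trans = λ f≋g g≋h n → trans (f≋g n) (g≋h n) }
                  ; ∙-cong = λ f≋f′ g≋g′ n → +-cong (f≋f′ n) (g≋g′ n) }
                ; assoc = λ f g h n → +-assoc (f n) (g n) (h n) }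
              ; identity = (λ f n → trans (+-congʳ (cst-0# n)) (+-identityˡ _))
                         , (λ f n → trans (+-congˡ (cst-0# n)) (+-identityʳ _)) }
            ; inverse = (λ f n → trans (-‿inverseˡ _) (sym (cst-0# n)))
                      , (λ f n → trans (-‿inverseʳ _) (sym (cst-0# n)))
            ; ⁻¹-cong = λ f≋g n → -‿cong (f≋g n) }
          ; comm = λ f g n → +-comm (f n) (g n) }
        ; *-cong = ⊛-cong
        ; *-assoc = ⊛-assoc
        ; *-identity = ⊛-identityˡ , ⊛-identityʳ
        ; distrib = ⊛-distribˡ , ⊛-distribʳ }
      ; *-comm = ⊛-comm } }

  open CommutativeRing powerSeriesRing public using () renaming (setoid to ps-setoid; ring to ps-ring)
  open import Algebra.Properties.Ring ps-ring using () renaming (-‿distribˡ-* to ⊝-distribˡ-⊛; -‿distribʳ-* to ⊝-distribʳ-⊛)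
  open import Algebra.Properties.Ring ring using (-1*x≈-x; -0#≈0#; -‿distribˡ-*)

  cst-⊛ : ∀ x F n → (cst x ⊛ F) n ≈ x * F n
  cst-⊛ x F zero    = +-identityʳ _
  cst-⊛ x F (suc n) = trans (⊛≈conv (cst x) F (suc n)) (trans (+-congˡ (conv-zeroˡ F n)) (+-identityʳ _))

  Z⊛-zero : ∀ F → (Z ⊛ F) 0 ≈ 0#
  Z⊛-zero F = trans (+-identityʳ _) (zeroˡ _)

  Z⊛-suc : ∀ F n → (Z ⊛ F) (suc n) ≈ F n
  Z⊛-suc F n = begin
    (Z ⊛ F) (suc n)                     ≈⟨ ⊛≈conv Z F (suc n) ⟩
    0# * F (suc n) + conv (Z ∘ suc) F n ≈⟨ +-cong (zeroˡ _) (conv-cong {g = F} Z∘suc≋1 (λ _ → refl) n) ⟩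
    0# + conv (cst 1#) F n              ≈⟨ trans (+-identityˡ _) (conv-identityˡ F n) ⟩
    F n                                 ∎
    where
    Z∘suc≋1 : Z ∘ suc ≋ cst 1#
    Z∘suc≋1 zero    = refl
    Z∘suc≋1 (suc k) = refl

  ⊛lin : ∀ F x → F ⊛ lin x ≋ F ⊕ (⊝ (cst x ⊛ (Z ⊛ F)))
  ⊛lin F x n = begin
    (F ⊛ lin x) n                                  ≈⟨ ⊛-distribˡ F (cst 1#) (⊝ (cst x ⊛ Z)) n ⟩
    (F ⊛ cst 1#) n + (F ⊛ (⊝ (cst x ⊛ Z))) n       ≈⟨ +-cong (⊛-identityʳ F n) (sym (⊝-distribʳ-⊛ F (cst x ⊛ Z) n)) ⟩
    F n - (F ⊛ (cst x ⊛ Z)) n                      ≈⟨ +-congˡ (-‿cong (trans (⊛-comm F _ n) (⊛-assoc (cst x) Z F n))) ⟩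
    F n - (cst x ⊛ (Z ⊛ F)) n                      ∎

  ⊛lin-zero : ∀ F x → (F ⊛ lin x) 0 ≈ F 0
  ⊛lin-zero F x = trans (⊛lin F x 0)
    (trans (+-congˡ (trans (-‿cong (trans (cst-⊛ x (Z ⊛ F) 0) (trans (*-congˡ (Z⊛-zero F)) (zeroʳ x)))) -0#≈0#)) (+-identityʳ _))

  ⊛lin-suc : ∀ F x n → (F ⊛ lin x) (suc n) ≈ F (suc n) - x * F n
  ⊛lin-suc F x n = trans (⊛lin F x (suc n)) (+-congˡ (-‿cong (trans (cst-⊛ x (Z ⊛ F) (suc n)) (*-congˡ (Z⊛-suc F n)))))

  lin⊛geom : ∀ x → lin x ⊛ geom x ≋ cst 1#
  lin⊛geom x n = trans (⊛-comm (lin x) (geom x) n) (geometric n)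
    where
    geometric : ∀ n → (geom x ⊛ lin x) n ≈ cst 1# n
    geometric zero    = ⊛lin-zero (geom x) x
    geometric (suc n) = trans (⊛lin-suc (geom x) x n) (-‿inverseʳ _)

  sumPSL-apply : ∀ {b} {B : Set b} (F : B → PS) xs k → sumPSL (map F xs) k ≈ sum (map (λ x → F x k) xs)
  sumPSL-apply F []       k = cst-0# k
  sumPSL-apply F (x ∷ xs) k = +-congˡ (sumPSL-apply F xs k)

  coeffShift-≤ : ∀ F {k d} → d ≤ k → coeffShift F k d ≡ F (k ∸ d)
  coeffShift-≤ F {k} {d} d≤k with d ≤? k
  ... | yes _   = ≡.refl
  ... | no  d≰k = ⊥-elim (d≰k d≤k)

  coeffShift-< : ∀ F {k d} → k < d → coeffShift F k d ≡ 0#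
  coeffShift-< F {k} {d} k<d with d ≤? k
  ... | yes d≤k = ⊥-elim (ℕₚ.<⇒≱ k<d d≤k)
  ... | no  _   = ≡.refl

  coeffShift-suc : ∀ F k d → coeffShift F (suc k) (suc d) ≡ coeffShift F k d
  coeffShift-suc F k d with d ≤? k
  ... | yes d≤k = coeffShift-≤ F (s≤s d≤k)
  ... | no  d≰k = coeffShift-< F (s≤s (ℕₚ.≰⇒> d≰k))

  -z² : PS
  -z² = ⊝ (Z ⊛ Z)

  -z²⊛ : ∀ G k → (-z² ⊛ G) k ≈ - (Z ⊛ (Z ⊛ G)) k
  -z²⊛ G k = trans (sym (⊝-distribˡ-⊛ (Z ⊛ Z) G k)) (-‿cong (⊛-assoc Z Z G k))

  pow-z²⊛ : ∀ m F k → (powPS -z² m ⊛ F) k ≈ pow (- 1#) m * coeffShift F k (2 ℕ.* m)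
  pow-z²⊛ zero    F k = trans (⊛-identityˡ F k) (sym (*-identityˡ _))
  pow-z²⊛ (suc m) F k = begin
    (powPS -z² (suc m) ⊛ F) k                         ≈⟨ ⊛-assoc -z² (powPS -z² m) F k ⟩
    (-z² ⊛ G) k                                       ≈⟨ -z²⊛ G k ⟩
    - (Z ⊛ (Z ⊛ G)) k                                 ≈⟨ shift k ⟩
    sgn * coeffShift F k (2 ℕ.+ 2 ℕ.* m)           ≡⟨ ≡.cong (λ d → sgn * coeffShift F k d) (ℕₚ.*-suc 2 m) ⟨
    sgn * coeffShift F k (2 ℕ.* suc m)             ∎
    where
    G = powPS -z² m ⊛ F
    sgn = pow (- 1#) (suc m)
    vanishing : ∀ {k} → k < 2 ℕ.+ 2 ℕ.* m → - 0# ≈ sgn * coeffShift F k (2 ℕ.+ 2 ℕ.* m)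
    vanishing k<d = trans -0#≈0# (sym (trans (*-congˡ (reflexive (coeffShift-< F k<d))) (zeroʳ _)))
    shift : ∀ k → - (Z ⊛ (Z ⊛ G)) k ≈ sgn * coeffShift F k (2 ℕ.+ 2 ℕ.* m)
    shift zero          = trans (-‿cong (Z⊛-zero (Z ⊛ G))) (vanishing (s≤s z≤n))
    shift (suc zero)    = trans (-‿cong (trans (Z⊛-suc (Z ⊛ G) 0) (Z⊛-zero G))) (vanishing (s≤s (s≤s z≤n)))
    shift (suc (suc k)) = begin
      - (Z ⊛ (Z ⊛ G)) (suc (suc k))                   ≈⟨ -‿cong (trans (Z⊛-suc (Z ⊛ G) (suc k)) (Z⊛-suc G k)) ⟩
      - G k                                           ≈⟨ -‿cong (pow-z²⊛ m F k) ⟩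
      - (pow (- 1#) m * coeffShift F k (2 ℕ.* m))     ≈⟨ trans (-‿distribˡ-* _ _) (*-congʳ (sym (-1*x≈-x _))) ⟩
      sgn * coeffShift F k (2 ℕ.* m)               ≡⟨ ≡.cong (sgn *_) (coeffShift-suc F k (2 ℕ.* m)) ⟨
      sgn * coeffShift F (suc k) (1 ℕ.+ 2 ℕ.* m)   ≡⟨ ≡.cong (sgn *_) (coeffShift-suc F (suc k) (1 ℕ.+ 2 ℕ.* m)) ⟨
      sgn * coeffShift F (suc (suc k)) (2 ℕ.+ 2 ℕ.* m) ∎

module ChainSums {c ℓ} (T : CommutativeRing c ℓ)
                 (w : ℕ → CommutativeRing.Carrier T) (x : CommutativeRing.Carrier T) where
  open CommutativeRing T
  open import Algebra.Definitions.RawSemiring (Semiring.rawSemiring semiring) using (_^_)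
  open Sums T
  open import Relation.Binary.Reasoning.Setoid setoid
  open import Algebra.Solver.Ring.NaturalCoefficients.Default commutativeSemiring
  open import Algebra.Properties.CommutativeSemigroup +-commutativeSemigroup using (xy∙z≈xz∙y)

  product : List Carrier → Carrier
  product = foldr _*_ 1#

  chainSum : (h lo m : ℕ) → Carrier
  chainSum h lo m = sum (map (product ∘ map w) (chains h lo m))

  chainSum-zero : ∀ h lo → chainSum h lo 0 ≈ 1#
  chainSum-zero h lo = +-identityʳ 1#

  chainSum-suc : ∀ h lo m → chainSum h lo (suc m) ≈ sum (map (λ k → w k * chainSum h (suc (suc k)) m) (range lo h))
  chainSum-suc h lo m = trans (sum-concatMap (product ∘ map w) (λ k → map (k ∷_) (chains h (suc (suc k)) m)) (range lo h))
    (sum-cong (λ k → trans (reflexive (sum-map (product ∘ map w) (k ∷_) (chains h (suc (suc k)) m)))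
                            (sum-*ˡ (w k) (product ∘ map w) (chains h (suc (suc k)) m))) (range lo h))

  chainSum-≤ : ∀ h lo m → lo ≤ h → chainSum h lo (suc m) ≈ w lo * chainSum h (suc (suc lo)) m + chainSum h (suc lo) (suc m)
  chainSum-≤ h lo m lo≤h = begin
    chainSum h lo (suc m)                                   ≈⟨ chainSum-suc h lo m ⟩
    sum (map term (range lo h))                             ≡⟨ ≡.cong (sum ∘ map term) (range-≤ lo≤h) ⟩
    w lo * chainSum h (suc (suc lo)) m + sum (map term (range (suc lo) h)) ≈⟨ +-congˡ (chainSum-suc h (suc lo) m) ⟨
    w lo * chainSum h (suc (suc lo)) m + chainSum h (suc lo) (suc m)       ∎
    where term = λ k → w k * chainSum h (suc (suc k)) m

  chainSum-> : ∀ h lo m → h < lo → chainSum h lo (suc m) ≈ 0#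
  chainSum-> h lo m h<lo = trans (chainSum-suc h lo m)
    (reflexive (≡.cong (λ ks → sum (map (λ k → w k * chainSum h (suc (suc k)) m) ks)) (range-> h<lo)))

  -- Truncated at m < M, so that no vanishing of chainSum on long chains is ever needed:
  -- Q≋prodLin⊛chainPoly below holds for every M > ⌊ h /2⌋.
  chainPoly : (M h lo : ℕ) → Carrier
  chainPoly M h lo = sum (map (λ m → x ^ m * chainSum h lo m) (upTo M))

  chainPoly-> : ∀ M h lo → h < lo → chainPoly (suc M) h lo ≈ 1#
  chainPoly-> M h lo h<lo = begin
    chainPoly (suc M) h lo                                         ≡⟨ sum-upTo-suc (λ m → x ^ m * chainSum h lo m) M ⟩
    1# * chainSum h lo 0 + sum (map (λ m → x ^ suc m * chainSum h lo (suc m)) (upTo M))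
      ≈⟨ +-cong (trans (*-identityˡ _) (chainSum-zero h lo))
                (trans (sum-cong (λ m → trans (*-congˡ (chainSum-> h lo m h<lo)) (zeroʳ _)) (upTo M)) (sum-0 (upTo M))) ⟩
    1# + 0#                                                        ≈⟨ +-identityʳ 1# ⟩
    1#                                                             ∎

  chainPoly-beyond : ∀ M {h lo h′ lo′} → h < lo → h′ < lo′ → chainPoly M h lo ≈ chainPoly M h′ lo′
  chainPoly-beyond zero    _    _      = refl
  chainPoly-beyond (suc M) h<lo h′<lo′ = trans (chainPoly-> M _ _ h<lo) (sym (chainPoly-> M _ _ h′<lo′))

  chainPoly-≤ : ∀ M h lo → lo ≤ h → chainPoly M h lo ≈ chainPoly M h (suc lo) + x * w lo * chainPoly (M ∸ 1) h (suc (suc lo))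
  chainPoly-≤ zero    h lo lo≤h = sym (trans (+-identityˡ _) (zeroʳ _))
  chainPoly-≤ (suc M) h lo lo≤h = begin
    chainPoly (suc M) h lo
      ≡⟨ sum-upTo-suc (λ m → x ^ m * chainSum h lo m) M ⟩
    1# * chainSum h lo 0 + sum (map (λ m → x ^ suc m * chainSum h lo (suc m)) (upTo M))
      ≈⟨ +-cong (*-congˡ (trans (chainSum-zero h lo) (sym (chainSum-zero h (suc lo)))))
                (sum-cong (λ m → trans (*-congˡ (chainSum-≤ h lo m lo≤h)) (split m)) (upTo M)) ⟩
    1# * chainSum h (suc lo) 0 + sum (map (λ m → skip m + x * w lo * take m) (upTo M))
      ≈⟨ +-congˡ (trans (sum-+ skip (λ m → x * w lo * take m) (upTo M)) (+-congˡ (sum-*ˡ (x * w lo) take (upTo M)))) ⟩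
    1# * chainSum h (suc lo) 0 + (sum (map skip (upTo M)) + x * w lo * sum (map take (upTo M)))
      ≈⟨ +-assoc _ _ _ ⟨
    (1# * chainSum h (suc lo) 0 + sum (map skip (upTo M))) + x * w lo * sum (map take (upTo M))
      ≡⟨ ≡.cong (_+ x * w lo * chainPoly M h (suc (suc lo))) (sum-upTo-suc (λ m → x ^ m * chainSum h (suc lo) m) M) ⟨
    chainPoly (suc M) h (suc lo) + x * w lo * chainPoly M h (suc (suc lo))
      ∎
    where
    skip take : ℕ → Carrier
    skip m = x ^ suc m * chainSum h (suc lo) (suc m)
    take m = x ^ m * chainSum h (suc (suc lo)) m
    split : ∀ m → x ^ suc m * (w lo * chainSum h (suc (suc lo)) m + chainSum h (suc lo) (suc m)) ≈ skip m + x * w lo * take m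
    split m = solve 5 (λ x xᵐ wₗ a b → x :* xᵐ :* (wₗ :* a :+ b) := x :* xᵐ :* b :+ x :* wₗ :* (xᵐ :* a)) refl
                x (x ^ m) (w lo) (chainSum h (suc (suc lo)) m) (chainSum h (suc lo) (suc m))

  -- Both sides satisfy the recurrence chainPoly-≤ in lo, so downward induction on lo from the
  -- two base cases lo = h + 2 and lo = h + 1 suffices.
  chainPoly-last : ∀ M h lo → lo ≤ suc (suc h) →
                   chainPoly M (suc (suc h)) lo ≈ chainPoly M (suc h) lo + x * w (suc (suc h)) * chainPoly (M ∸ 1) h lo
  chainPoly-last M h lo lo≤h+2 = byGap (suc (suc h) ∸ lo) lo (ℕₚ.m∸n+n≡m lo≤h+2) M
    where
    Last : ℕ → ℕ → Set ℓ
    Last M lo = chainPoly M (suc (suc h)) lo ≈ chainPoly M (suc h) lo + x * w (suc (suc h)) * chainPoly (M ∸ 1) h lo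

    h<h+2 : h < suc (suc h)
    h<h+2 = ℕₚ.m<n⇒m<1+n (ℕₚ.n<1+n h)

    last-h+2 : ∀ M → Last M (suc (suc h))
    last-h+2 M = begin
      chainPoly M (suc (suc h)) (suc (suc h))
        ≈⟨ chainPoly-≤ M _ _ ℕₚ.≤-refl ⟩
      chainPoly M (suc (suc h)) (3 ℕ.+ h) + x * w (suc (suc h)) * chainPoly (M ∸ 1) (suc (suc h)) (4 ℕ.+ h)
        ≈⟨ +-cong (chainPoly-beyond M (ℕₚ.n<1+n _) (ℕₚ.n<1+n _))
                  (*-congˡ (chainPoly-beyond (M ∸ 1) (ℕₚ.m<n⇒m<1+n (ℕₚ.n<1+n _)) h<h+2)) ⟩
      chainPoly M (suc h) (suc (suc h)) + x * w (suc (suc h)) * chainPoly (M ∸ 1) h (suc (suc h))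
        ∎

    last-h+1 : ∀ M → Last M (suc h)
    last-h+1 M = begin
      chainPoly M (suc (suc h)) (suc h)
        ≈⟨ chainPoly-≤ M _ _ (ℕₚ.n≤1+n _) ⟩
      chainPoly M (suc (suc h)) (suc (suc h)) + x * w (suc h) * chainPoly (M ∸ 1) (suc (suc h)) (3 ℕ.+ h)
        ≈⟨ +-cong (last-h+2 M) (*-congˡ (chainPoly-beyond (M ∸ 1) (ℕₚ.n<1+n _) (ℕₚ.m<n⇒m<1+n (ℕₚ.n<1+n _)))) ⟩
      (chainPoly M (suc h) (suc (suc h)) + x * w (suc (suc h)) * chainPoly (M ∸ 1) h (suc (suc h)))
        + x * w (suc h) * chainPoly (M ∸ 1) (suc h) (3 ℕ.+ h)
        ≈⟨ xy∙z≈xz∙y _ _ _ ⟩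
      (chainPoly M (suc h) (suc (suc h)) + x * w (suc h) * chainPoly (M ∸ 1) (suc h) (3 ℕ.+ h))
        + x * w (suc (suc h)) * chainPoly (M ∸ 1) h (suc (suc h))
        ≈⟨ +-cong (chainPoly-≤ M _ _ ℕₚ.≤-refl) (*-congˡ (chainPoly-beyond (M ∸ 1) (ℕₚ.n<1+n h) h<h+2)) ⟨
      chainPoly M (suc h) (suc h) + x * w (suc (suc h)) * chainPoly (M ∸ 1) h (suc h)
        ∎

    last-≤h : ∀ lo → lo ≤ h → (∀ M → Last M (suc lo)) → (∀ M → Last M (suc (suc lo))) → ∀ M → Last M lo
    last-≤h lo lo≤h last₁ last₂ M = begin
      chainPoly M (suc (suc h)) lo
        ≈⟨ chainPoly-≤ M _ lo (ℕₚ.m≤n⇒m≤1+n (ℕₚ.m≤n⇒m≤1+n lo≤h)) ⟩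
      chainPoly M (suc (suc h)) (suc lo) + x * w lo * chainPoly (M ∸ 1) (suc (suc h)) (suc (suc lo))
        ≈⟨ +-cong (last₁ M) (*-congˡ (last₂ (M ∸ 1))) ⟩
      (chainPoly M (suc h) (suc lo) + x * wₕ * chainPoly (M ∸ 1) h (suc lo))
        + x * w lo * (chainPoly (M ∸ 1) (suc h) (suc (suc lo)) + x * wₕ * chainPoly (M ∸ 1 ∸ 1) h (suc (suc lo)))
        ≈⟨ regroup _ _ _ _ x (w lo) wₕ ⟩
      (chainPoly M (suc h) (suc lo) + x * w lo * chainPoly (M ∸ 1) (suc h) (suc (suc lo)))
        + x * wₕ * (chainPoly (M ∸ 1) h (suc lo) + x * w lo * chainPoly (M ∸ 1 ∸ 1) h (suc (suc lo)))
        ≈⟨ +-cong (chainPoly-≤ M _ lo (ℕₚ.m≤n⇒m≤1+n lo≤h)) (*-congˡ (chainPoly-≤ (M ∸ 1) h lo lo≤h)) ⟨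
      chainPoly M (suc h) lo + x * wₕ * chainPoly (M ∸ 1) h lo
        ∎
      where
      wₕ = w (suc (suc h))
      regroup : ∀ a b c d x u v → (a + x * v * b) + x * u * (c + x * v * d) ≈ (a + x * u * c) + x * v * (b + x * u * d)
      regroup = solve 7 (λ a b c d x u v → (a :+ x :* v :* b) :+ x :* u :* (c :+ x :* v :* d)
                                        := (a :+ x :* u :* c) :+ x :* v :* (b :+ x :* u :* d)) refl

    byGap : ∀ d lo → d ℕ.+ lo ≡ suc (suc h) → ∀ M → Last M lo
    byGap zero          lo ≡.refl = last-h+2
    byGap (suc zero)    lo ≡.refl = last-h+1
    byGap (suc (suc d)) lo eq     =
      last-≤h lo (≡.subst (lo ≤_) (ℕₚ.suc-injective (ℕₚ.suc-injective eq)) (ℕₚ.m≤n+m lo d))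
        (byGap (suc d) (suc lo) (≡.trans (ℕₚ.+-suc (suc d) lo) eq))
        (byGap d (suc (suc lo)) (≡.trans (ℕₚ.+-suc d (suc lo)) (≡.trans (≡.cong suc (ℕₚ.+-suc d lo)) eq)))

module IndicatorSums {a ℓ} (R : CommutativeRing a ℓ) where
  open CommutativeRing R hiding (zero)
  open PowerSeries R
  open PowerSeriesRing R
  open Sums R

  indicator-≡ : ∀ s → indicator s s ≈ 1#
  indicator-≡ s with s ℕ.≟ s
  ... | yes _  = refl
  ... | no s≢s = ⊥-elim (s≢s ≡.refl)

  indicator-≢ : ∀ {s t} → s ≢ t → indicator s t ≈ 0#
  indicator-≢ {s} {t} s≢t with s ℕ.≟ t
  ... | yes s≡t = ⊥-elim (s≢t s≡t)
  ... | no  _   = refl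

  sum-indicator-upTo-≤ : ∀ σ K → K ≤ σ → sum (map (indicator σ) (upTo K)) ≈ 0#
  sum-indicator-upTo-≤ σ zero    _     = refl
  sum-indicator-upTo-≤ σ (suc K) K<σ =
    trans (sum-upTo-∷ʳ (indicator σ) K)
          (trans (+-cong (sum-indicator-upTo-≤ σ K (ℕₚ.<⇒≤ K<σ)) (indicator-≢ (ℕₚ.>⇒≢ K<σ))) (+-identityʳ 0#))

  sum-indicator-upTo-> : ∀ σ K → σ < K → sum (map (indicator σ) (upTo K)) ≈ 1#
  sum-indicator-upTo-> σ (suc K) σ<K+1 = trans (sum-upTo-∷ʳ (indicator σ) K) (lastOrEarlier (ℕₚ.m≤n⇒m<n∨m≡n (ℕₚ.≤-pred σ<K+1)))
    where
    lastOrEarlier : σ < K ⊎ σ ≡ K → sum (map (indicator σ) (upTo K)) + indicator σ K ≈ 1#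
    lastOrEarlier (inj₁ σ<K)    = trans (+-cong (sum-indicator-upTo-> σ K σ<K) (indicator-≢ (ℕₚ.<⇒≢ σ<K))) (+-identityʳ 1#)
    lastOrEarlier (inj₂ ≡.refl) = trans (+-cong (sum-indicator-upTo-≤ σ σ ℕₚ.≤-refl) (indicator-≡ σ)) (+-identityˡ 1#)

  sumPS-indicator : ∀ σ L → σ ≤ L → sumPS 0 L (cst ∘ indicator σ) ≋ cst 1#
  sumPS-indicator σ L σ≤L n = trans (sumPSL-apply (cst ∘ indicator σ) (range 0 L) n) (atDegree n)
    where
    atDegree : ∀ n → sum (map (λ s → cst (indicator σ s) n) (range 0 L)) ≈ cst 1# n
    atDegree zero    = trans (reflexive (sum-map (indicator σ) (0 ℕ.+_) (upTo (suc L)))) (sum-indicator-upTo-> σ (suc L) (s≤s σ≤L))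
    atDegree (suc n) = sum-0 (range 0 L)

chains-sum≤ : ∀ h lo m → All (λ ks → sumℕ ks ≤ m ℕ.* h) (chains h lo m)
chains-sum≤ h lo zero    = z≤n ∷ []
chains-sum≤ h lo (suc m) = Allₚ.concat⁺ (Allₚ.map⁺ (All-range lo h (λ k k≤h →
  Allₚ.map⁺ (All.map (ℕₚ.+-mono-≤ k≤h) (chains-sum≤ h (suc (suc k)) m)))))

module ContinuantPolynomials {a ℓ} (R : CommutativeRing a ℓ) (c ab : ℕ → CommutativeRing.Carrier R) where
  open CommutativeRing R hiding (zero)
  open PowerSeries R
  open PowerSeriesRing R
  open IndicatorSums R
  open Sums R
  module ℙ = CommutativeRing powerSeriesRing
  module Σℙ = Sums powerSeriesRing
  open ChainSums powerSeriesRing (term c ab) -z²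
  open import Algebra.Definitions.RawSemiring (Semiring.rawSemiring ℙ.semiring) using (_^_)

  sumPS-S : ∀ h m Y → sumPS 0 (m ℕ.* h) (λ s → Y ⊛ S c ab h m s) ≋ Y ⊛ chainSum h 2 m
  sumPS-S h m Y = begin
    sumPS 0 (m ℕ.* h) (λ s → Y ⊛ S c ab h m s)
      ≈⟨ Σℙ.sum-*ˡ Y (S c ab h m) (range 0 (m ℕ.* h)) ⟩
    Y ⊛ sumPSL (map (S c ab h m) (range 0 (m ℕ.* h)))
      ≈⟨ ℙ.*-congˡ (Σℙ.sum-comm weighted (range 0 (m ℕ.* h)) (chains h 2 m)) ⟩
    Y ⊛ sumPSL (map (λ ks → sumPS 0 (m ℕ.* h) (λ s → weighted s ks)) (chains h 2 m))
      ≈⟨ ℙ.*-congˡ (Σℙ.sum-congᴬ (All.map (λ {ks} → collapse {ks}) (chains-sum≤ h 2 m))) ⟩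
    Y ⊛ chainSum h 2 m
      ∎
    where
    open import Relation.Binary.Reasoning.Setoid ps-setoid
    weighted : ℕ → List ℕ → PS
    weighted s ks = cst (indicator (sumℕ ks) s) ⊛ product (map (term c ab) ks)
    collapse : ∀ {ks} → sumℕ ks ≤ m ℕ.* h → sumPS 0 (m ℕ.* h) (λ s → weighted s ks) ≋ product (map (term c ab) ks)
    collapse {ks} Σks≤mh = ℙ.trans (Σℙ.sum-*ʳ _ (cst ∘ indicator (sumℕ ks)) (range 0 (m ℕ.* h)))
                                   (ℙ.trans (ℙ.*-congʳ (sumPS-indicator (sumℕ ks) (m ℕ.* h) Σks≤mh)) (⊛-identityˡ _))

  -- In the step, lin⊛geom cancels the denominators of term (h + 2) against prodLin (h + 2).
  Q≋prodLin⊛chainPoly : ∀ h M → ⌊ h /2⌋ < M → Q c ab h ≋ prodLin c ab h ⊛ chainPoly M h 2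
  Q≋prodLin⊛chainPoly 0 (suc M) _ =
    ℙ.sym (ℙ.trans (⊛-identityˡ _) (chainPoly-> M 0 2 (s≤s z≤n)))
  Q≋prodLin⊛chainPoly 1 (suc M) _ =
    ℙ.sym (ℙ.trans (ℙ.*-congˡ (chainPoly-> M 1 2 ℕₚ.≤-refl)) (ℙ.trans (⊛-identityʳ _) (⊛-identityˡ _)))
  Q≋prodLin⊛chainPoly (suc (suc h)) (suc M) (s≤s h/2<M) = ℙ.sym (begin
    (P₂ ⊛ chainPoly (suc M) (suc (suc h)) 2)
      ≈⟨ ℙ.*-congˡ (chainPoly-last (suc M) h 2 (s≤s (s≤s z≤n))) ⟩
    (P₂ ⊛ (chainPoly (suc M) (suc h) 2 ⊕ ((-z² ⊛ (α ⊛ (g₂ ⊛ g₁))) ⊛ chainPoly M h 2)))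
      ≈⟨ regroup P₀ l₁ l₂ g₁ g₂ -z² α (chainPoly (suc M) (suc h) 2) (chainPoly M h 2) ⟩
    ((l₂ ⊛ (P₁ ⊛ chainPoly (suc M) (suc h) 2)) ⊕ (((-z² ⊛ α) ⊛ (P₀ ⊛ chainPoly M h 2)) ⊛ ((l₁ ⊛ g₁) ⊛ (l₂ ⊛ g₂))))
      ≈⟨ ℙ.+-cong (ℙ.*-congˡ (ℙ.sym (Q≋prodLin⊛chainPoly (suc h) (suc M) (s≤s ⌊h+1/2⌋≤M))))
                  (ℙ.*-cong (ℙ.*-congˡ (ℙ.sym (Q≋prodLin⊛chainPoly h M h/2<M))) (ℙ.*-cong (lin⊛geom (c (suc h))) (lin⊛geom (c (suc (suc h)))))) ⟩
    ((l₂ ⊛ Q c ab (suc h)) ⊕ (((-z² ⊛ α) ⊛ Q c ab h) ⊛ (cst 1# ⊛ cst 1#)))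
      ≈⟨ ℙ.+-congˡ (ℙ.trans (ℙ.*-congˡ (⊛-identityˡ _)) (ℙ.trans (⊛-identityʳ _) (-z²-term α (Q c ab h)))) ⟩
    Q c ab (suc (suc h))
      ∎)
    where
    open import Relation.Binary.Reasoning.Setoid ps-setoid
    open import Algebra.Solver.Ring.NaturalCoefficients.Default ℙ.commutativeSemiring
    open import Algebra.Properties.Ring ps-ring using () renaming (-‿distribˡ-* to ⊝-distribˡ-⊛)
    α = cst (ab (suc (suc h)))
    P₀ = prodLin c ab h
    P₁ = prodLin c ab (suc h)
    P₂ = prodLin c ab (suc (suc h))
    l₁ = lin (c (suc h))
    l₂ = lin (c (suc (suc h)))
    g₁ = geom (c (suc h))
    g₂ = geom (c (suc (suc h)))
    ⌊h+1/2⌋≤M : ⌊ suc h /2⌋ ≤ M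
    ⌊h+1/2⌋≤M = ℕₚ.≤-trans (ℕₚ.⌊n/2⌋-mono (ℕₚ.n≤1+n (suc h))) h/2<M
    regroup : ∀ p l₁ l₂ g₁ g₂ x α G₁ G₀ →
              (((p ⊛ l₁) ⊛ l₂) ⊛ (G₁ ⊕ ((x ⊛ (α ⊛ (g₂ ⊛ g₁))) ⊛ G₀)))
              ≋ ((l₂ ⊛ ((p ⊛ l₁) ⊛ G₁)) ⊕ (((x ⊛ α) ⊛ (p ⊛ G₀)) ⊛ ((l₁ ⊛ g₁) ⊛ (l₂ ⊛ g₂))))
    regroup = solve 9 (λ p l₁ l₂ g₁ g₂ x α G₁ G₀ →
                         ((p :* l₁) :* l₂) :* (G₁ :+ ((x :* (α :* (g₂ :* g₁))) :* G₀))
                      := (l₂ :* ((p :* l₁) :* G₁)) :+ (((x :* α) :* (p :* G₀)) :* ((l₁ :* g₁) :* (l₂ :* g₂)))) ℙ.refl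
    -z²-term : ∀ α q → ((-z² ⊛ α) ⊛ q) ≋ (⊝ ((α ⊛ (Z ⊛ Z)) ⊛ q))
    -z²-term α q = ℙ.trans (ℙ.*-congʳ (ℙ.trans (ℙ.sym (⊝-distribˡ-⊛ (Z ⊛ Z) α)) (ℙ.-‿cong (⊛-comm (Z ⊛ Z) α))))
                           (ℙ.sym (⊝-distribˡ-⊛ (α ⊛ (Z ⊛ Z)) q))

  prodLin≈bracket : ∀ h n → prodLin c ab h n ≈ bracket c ab h n
  prodLin≈bracket zero    zero    = refl
  prodLin≈bracket zero    (suc n) = refl
  prodLin≈bracket (suc h) zero    = trans (⊛lin-zero (prodLin c ab h) (c (suc h))) (prodLin≈bracket h 0)
  prodLin≈bracket (suc h) (suc n) = trans (⊛lin-suc (prodLin c ab h) (c (suc h)) n)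
    (+-cong (prodLin≈bracket h (suc n)) (-‿cong (*-congˡ (prodLin≈bracket h n))))

  ΣS : ℕ → PS
  ΣS h = sumPS 1 ⌊ h /2⌋ (λ m → sumPS 0 (m ℕ.* h) (λ s → powPS -z² m ⊛ S c ab h m s))

  ^≡powPS : ∀ f m → f ^ m ≡ powPS f m
  ^≡powPS f zero    = ≡.refl
  ^≡powPS f (suc m) = ≡.cong (f ⊛_) (^≡powPS f m)

  chainPoly≋1+ΣS : ∀ h → chainPoly (suc ⌊ h /2⌋) h 2 ≋ (cst 1# ⊕ ΣS h)
  chainPoly≋1+ΣS h = begin
    chainPoly (suc N) h 2
      ≡⟨ Σℙ.sum-upTo-suc (λ m → (-z² ^ m) ⊛ chainSum h 2 m) N ⟩
    ((cst 1# ⊛ chainSum h 2 0) ⊕ sumPSL (map (λ m → (-z² ^ suc m) ⊛ chainSum h 2 (suc m)) (upTo N)))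
      ≈⟨ ℙ.+-cong (ℙ.trans (⊛-identityˡ _) (chainSum-zero h 2))
                  (Σℙ.sum-cong (λ m → ℙ.sym (ℙ.trans (sumPS-S h (suc m) (powPS -z² (suc m)))
                                                     (ℙ.reflexive (≡.cong (_⊛ chainSum h 2 (suc m)) (≡.sym (^≡powPS -z² (suc m)))))))
                               (upTo N)) ⟩
    (cst 1# ⊕ sumPSL (map (F ∘ suc) (upTo N)))
      ≡⟨ ≡.cong (cst 1# ⊕_) (Σℙ.sum-map F suc (upTo N)) ⟨
    (cst 1# ⊕ ΣS h)
      ∎
    where
    open import Relation.Binary.Reasoning.Setoid ps-setoid
    N = ⌊ h /2⌋
    F : ℕ → PS
    F m = sumPS 0 (m ℕ.* h) (λ s → powPS -z² m ⊛ S c ab h m s)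

  Q≋prodLin⊛1+ΣS : ∀ h → Q c ab h ≋ prodLin c ab h ⊛ (cst 1# ⊕ ΣS h)
  Q≋prodLin⊛1+ΣS h = ℙ.trans (Q≋prodLin⊛chainPoly h (suc ⌊ h /2⌋) ℕₚ.≤-refl) (ℙ.*-congˡ (chainPoly≋1+ΣS h))

  Q-coefficient : ∀ h n → Q c ab h n ≈
    bracket c ab h n + sumRange 1 ⌊ h /2⌋ (λ m → sumRange 0 (m ℕ.* h) (λ s → sumRange 0 n (λ k →
      pow (- 1#) m * bracket c ab h (n ∸ k) * coeffShift (S c ab h m s) k (2 ℕ.* m))))
  Q-coefficient h n = begin
    Q c ab h n
      ≈⟨ Q≋prodLin⊛1+ΣS h n ⟩
    (P ⊛ (cst 1# ⊕ ΣS h)) n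
      ≈⟨ ⊛-distribˡ P (cst 1#) (ΣS h) n ⟩
    (P ⊛ cst 1#) n + (P ⊛ ΣS h) n
      ≈⟨ +-cong (trans (⊛-identityʳ P n) (prodLin≈bracket h n)) (⊛-comm P (ΣS h) n) ⟩
    bracket c ab h n + (ΣS h ⊛ P) n
      ≈⟨ +-congˡ (ℙ.trans (ℙ.sym (Σℙ.sum-*ʳ P G ms)) (Σℙ.sum-cong (λ m → ℙ.sym (Σℙ.sum-*ʳ P (F m) (ss m))) ms) n) ⟩
    bracket c ab h n + sumPSL (map (λ m → sumPSL (map (λ s → F m s ⊛ P) (ss m))) ms) n
      ≈⟨ +-congˡ (trans (sumPSL-apply _ ms n) (sum-cong (λ m → sumPSL-apply (λ s → F m s ⊛ P) (ss m) n) ms)) ⟩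
    bracket c ab h n + sum (map (λ m → sum (map (λ s → (F m s ⊛ P) n) (ss m))) ms)
      ≈⟨ +-congˡ (sum-cong (λ m → sum-cong (λ s → sum-cong (coefficient m s) (range 0 n)) (ss m)) ms) ⟩
    bracket c ab h n + sumRange 1 ⌊ h /2⌋ (λ m → sumRange 0 (m ℕ.* h) (λ s → sumRange 0 n (λ k →
      pow (- 1#) m * bracket c ab h (n ∸ k) * coeffShift (S c ab h m s) k (2 ℕ.* m))))
      ∎
    where
    open import Relation.Binary.Reasoning.Setoid setoid
    open import Algebra.Solver.Ring.NaturalCoefficients.Default commutativeSemiring
    P = prodLin c ab h
    ms = range 1 ⌊ h /2⌋
    ss : ℕ → List ℕ
    ss m = range 0 (m ℕ.* h)
    F : ℕ → ℕ → PS
    F m s = powPS -z² m ⊛ S c ab h m s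
    G : ℕ → PS
    G m = sumPSL (map (F m) (ss m))
    swap₂₃ : ∀ u v w → u * v * w ≈ u * w * v
    swap₂₃ = solve 3 (λ u v w → u :* v :* w := u :* w :* v) refl
    coefficient : ∀ m s k → F m s k * P (n ∸ k) ≈ pow (- 1#) m * bracket c ab h (n ∸ k) * coeffShift (S c ab h m s) k (2 ℕ.* m)
    coefficient m s k = trans (*-cong (pow-z²⊛ m (S c ab h m s) k) (prodLin≈bracket h (n ∸ k))) (swap₂₃ _ _ _)

lemma2p3 : ∀ {a ℓ} (R : CommutativeRing a ℓ) (c ab : ℕ → CommutativeRing.Carrier R) (h : ℕ) → 2 ≤ h →
    let open CommutativeRing R hiding (zero)
        open PowerSeries R
    in ((j : ℕ) →
          Q c ab h j ≈
          (prodLin c ab h ⊛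
             (cst 1# ⊕ sumPS 1 ⌊ h /2⌋ (λ m → sumPS 0 (m ℕ.* h) (λ s →
                 powPS (⊝ (Z ⊛ Z)) m ⊛ S c ab h m s)))) j)
       × ((n : ℕ) → n ≤ h →
          Q c ab h n ≈
          bracket c ab h n + sumRange 1 ⌊ h /2⌋ (λ m → sumRange 0 (m ℕ.* h) (λ s → sumRange 0 n (λ k →
              pow (- 1#) m * bracket c ab h (n ℕ.∸ k) * coeffShift (S c ab h m s) k (2 ℕ.* m)))))
lemma2p3 R c ab h _ = Q≋prodLin⊛1+ΣS h , λ n _ → Q-coefficient h n
  where open ContinuantPolynomials R c ab
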